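{- Let $N, N' \in \mathcal{N}_n$. Then $d_{\mathrm{PR}}(N, N') \leq d_{\mathrm{SNPR}}(N, N') \leq 2\, d_{\mathrm{PR}}(N, N')$.
   Context: A rooted binary phylogenetic network $N$ on $X=\{1,\dots,n\}$ is a directed acyclic graph, in which parallel edges are allowed, whose vertices are of the following kinds: a unique root labelled $\rho$ (in-degree $0$, out-degree $1$); leaves (in-degree $1$, out-degree $0$), bijectively labelled by $X$; inner tree vertices (in-degree $1$, out-degree $2$); and reticulations (in-degree $2$, out-degree $1$). Tree vertices are the inner tree vertices, the leaves and the root. $\mathcal{N}_n$ is the set of all such networks. An edge $(u,v)$ is an ancestor of an edge $(x,y)$, and of the vertex $x$, if $v=x$ or there is a directed path from $v$ to $x$; these are then its descendants. PR operation on an edge $e=(u,v)$ of $N$, producing a network in $\mathcal{N}_n$. The operation takes one of the following forms. (tail PR0) If $u$ is a tree vertex other than $\rho$: delete $e$, suppress $u$, subdivide an edge that is not a descendant of $v$ with a new vertex $u'$, and add $(u',v)$. (head PR0) If $v$ is a reticulation: delete $e$, suppress $v$, subdivide an edge that is not an ancestor of $u$ with a new vertex $v'$, and add $(u,v')$. (PR+) Subdivide $e$ with a new vertex $v'$, subdivide an edge that is not a descendant of $v'$ with a new vertex $u'$, and add $(u',v')$. (PR−) If $u$ is a tree vertex and $v$ is a reticulation: delete $e$ and suppress $u$ and $v$. An SNPR operation is a PR operation of type tail PR0, PR+ or PR− (that is, head PR0 is excluded). $d_{\mathrm{PR}}$ and $d_{\mathrm{SNPR}}$ denote the minimum number of PR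 operations, respectively SNPR operations, needed to transform $N$ into $N'$. -}

module Defs where

open import Data.Nat using (ℕ; zero; suc; _+_; _*_; _≤_)
open import Data.Fin using (Fin; zero; suc)
open import Data.Fin.Properties using (_≟_)
open import Data.Product using (Σ; ∃; ∃-syntax; _×_; _,_; proj₁; proj₂)
open import Data.Sum using (_⊎_)
open import Data.List using (List; []; _∷_; map; filter; length)
open import Data.List.Relation.Unary.All using (All)
open import Data.List.Membership.Propositional using (_∈_)
open import Data.List.Relation.Binary.Permutation.Propositional using (_↭_)
open import Relation.Binary.PropositionalEquality using (_≡_; _≢_)
open import Relation.Nullary using (¬_)
open import Function.Definitions using (Injective)

-- Raw directed multigraphs on vertex set Fin m.
-- Edges form a list (so parallel edges are allowed; an edge occurrence
-- is selected by decomposing the list up to permutation).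

Edge : ℕ → Set
Edge m = Fin m × Fin m

indeg : ∀ {m} → List (Edge m) → Fin m → ℕ
indeg E x = length (filter (λ e → proj₂ e ≟ x) E)

outdeg : ∀ {m} → List (Edge m) → Fin m → ℕ
outdeg E x = length (filter (λ e → proj₁ e ≟ x) E)

data Reach {m : ℕ} (E : List (Edge m)) : Fin m → Fin m → Set where
  here  : ∀ {a} → Reach E a a
  step  : ∀ {a c b} → (a , c) ∈ E → Reach E c b → Reach E a b

record RawGraph (n : ℕ) : Set where
  field
    size  : ℕ
    edges : List (Edge size)
    root  : Fin size
    leaf  : Fin n → Fin size
open RawGraph public

record IsNetwork {n : ℕ} (G : RawGraph n) : Set where
  field
    root-deg  : indeg (edges G) (root G) ≡ 0 × outdeg (edges G) (root G) ≡ 1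
    leaf-deg  : ∀ i → indeg (edges G) (leaf G i) ≡ 1 × outdeg (edges G) (leaf G i) ≡ 0
    leaf-inj  : Injective _≡_ _≡_ (leaf G)
    kinds     : ∀ x → x ≡ root G
                    ⊎ (∃[ i ] leaf G i ≡ x)
                    ⊎ (indeg (edges G) x ≡ 1 × outdeg (edges G) x ≡ 2)
                    ⊎ (indeg (edges G) x ≡ 2 × outdeg (edges G) x ≡ 1)
    acyclic   : ∀ {x y} → (x , y) ∈ edges G → ¬ Reach (edges G) y x

record Network (n : ℕ) : Set where
  field
    graph     : RawGraph n
    isNetwork : IsNetwork graph
open Network public

IsReticulation : ∀ {n} (G : RawGraph n) → Fin (size G) → Set
IsReticulation G x = indeg (edges G) x ≡ 2 × outdeg (edges G) x ≡ 1

IsTreeVertex : ∀ {n} (G : RawGraph n) → Fin (size G) → Set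
IsTreeVertex G x = (indeg (edges G) x ≡ 1 × outdeg (edges G) x ≡ 2)
                 ⊎ (∃[ i ] leaf G i ≡ x)
                 ⊎ x ≡ root G

-- When H is a network (no isolated vertices) this says G is H plus
-- isolated vertices; between two networks it is label-preserving
-- isomorphism.

Embeds : ∀ {n} → RawGraph n → RawGraph n → Set
Embeds H G =
  Σ (Fin (size H) → Fin (size G)) λ φ →
    Injective _≡_ _≡_ φ
    × map (λ e → φ (proj₁ e) , φ (proj₂ e)) (edges H) ↭ edges G
    × φ (root H) ≡ root G
    × (∀ i → φ (leaf H i) ≡ leaf G i)

-- Operations are performed on the vertex
-- set Fin (2 + m): old vertices are suc ∘ suc, and zero, suc zero are
-- fresh vertices available for subdivisions.  Suppressed vertices are
-- left isolated (they disappear under Embeds).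

old : ∀ {m} → Fin m → Fin (2 + m)
old x = suc (suc x)

new₀ new₁ : ∀ {m} → Fin (2 + m)
new₀ = zero
new₁ = suc zero

liftE : ∀ {m} → List (Edge m) → List (Edge (2 + m))
liftE = map (λ e → old (proj₁ e) , old (proj₂ e))

Suppress : ∀ {k} → Fin k → List (Edge k) → List (Edge k) → Set
Suppress x F F' =
  ∃[ p ] ∃[ q ] ∃[ R ]
    F ↭ ((p , x) ∷ (x , q) ∷ R)
    × All (λ e → proj₁ e ≢ x × proj₂ e ≢ x) R
    × F' ≡ (p , q) ∷ R

module _ {n : ℕ} (N : Network n) where
  private
    G = graph N
    m = size G
    L = liftE (edges G)

  TailPR0 : List (Edge (2 + m)) → Set
  TailPR0 F =
    ∃[ u ] ∃[ v ] ∃[ R₀ ] ∃[ R₁ ] ∃[ x ] ∃[ y ] ∃[ R₂ ]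
      L ↭ ((old u , old v) ∷ R₀)
      × IsTreeVertex G u × u ≢ root G
      × Suppress (old u) R₀ R₁
      × R₁ ↭ ((x , y) ∷ R₂)
      × ¬ Reach R₁ (old v) x
      × F ≡ (x , new₀) ∷ (new₀ , y) ∷ (new₀ , old v) ∷ R₂

  HeadPR0 : List (Edge (2 + m)) → Set
  HeadPR0 F =
    ∃[ u ] ∃[ v ] ∃[ R₀ ] ∃[ R₁ ] ∃[ x ] ∃[ y ] ∃[ R₂ ]
      L ↭ ((old u , old v) ∷ R₀)
      × IsReticulation G v
      × Suppress (old v) R₀ R₁
      × R₁ ↭ ((x , y) ∷ R₂)
      × ¬ Reach R₁ y (old u)
      × F ≡ (x , new₀) ∷ (new₀ , y) ∷ (old u , new₀) ∷ R₂

  PRplus : List (Edge (2 + m)) → Set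
  PRplus F =
    ∃[ u ] ∃[ v ] ∃[ R₀ ] ∃[ x ] ∃[ y ] ∃[ R₂ ]
      L ↭ ((old u , old v) ∷ R₀)
      × ((old u , new₀) ∷ (new₀ , old v) ∷ R₀) ↭ ((x , y) ∷ R₂)
      × ¬ Reach ((old u , new₀) ∷ (new₀ , old v) ∷ R₀) new₀ x
      × F ≡ (x , new₁) ∷ (new₁ , y) ∷ (new₁ , new₀) ∷ R₂

  PRminus : List (Edge (2 + m)) → Set
  PRminus F =
    ∃[ u ] ∃[ v ] ∃[ R₀ ] ∃[ R₁ ]
      L ↭ ((old u , old v) ∷ R₀)
      × IsTreeVertex G u × IsReticulation G v
      × Suppress (old u) R₀ R₁
      × Suppress (old v) R₁ F

  result : List (Edge (2 + m)) → RawGraph n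
  result F = record { size = 2 + m ; edges = F ; root = old (root G)
                    ; leaf = λ i → old (leaf G i) }

PR : ∀ {n} → Network n → Network n → Set
PR N N' = ∃[ F ] (TailPR0 N F ⊎ HeadPR0 N F ⊎ PRplus N F ⊎ PRminus N F)
                 × Embeds (graph N') (result N F)

SNPR : ∀ {n} → Network n → Network n → Set
SNPR N N' = ∃[ F ] (TailPR0 N F ⊎ PRplus N F ⊎ PRminus N F)
                   × Embeds (graph N') (result N F)

data Steps {n : ℕ} (R : Network n → Network n → Set)
     : ℕ → Network n → Network n → Set where
  done : ∀ {N N'} → Embeds (graph N') (graph N) → Steps R 0 N N'
  more : ∀ {k N N₁ N'} → R N N₁ → Steps R k N₁ N' → Steps R (suc k) N N'

IsDist : ∀ {n} → (Network n → Network n → Set) → Network n → Network n → ℕ → Set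
IsDist R N N' d = Steps R d N N' × (∀ k → Steps R k N N' → d ≤ k)

-- Every SNPR operation is a PR operation, so d_PR ≤ d_SNPR.  Conversely, a head
-- PR0 moving the head of (u,v) from the reticulation v onto an edge (a,b) equals
-- a PR+ followed by a PR−: subdivide (u,v) by u' and (a,b) by v', add (u',v'),
-- then delete (u',v) and suppress u' and v.  Hence every PR sequence can be
-- replaced by an SNPR sequence at most twice as long.  The substance is that the
-- intermediate graph is again a network, i.e. acyclic: a cycle through (u',v')
-- would need a path from v' back to u, hence a path from b to u avoiding (u,v),
-- which is exactly what the head PR0 side condition excludes.
module Submission where

open import Defs
open import Data.Nat using (ℕ; _≤_; _*_)
open import Data.Product using (_×_)
open import Data.Nat using (suc; _+_; z≤n; s≤s)
open import Data.Nat.Properties using (≤-trans; ≤-reflexive; n≤1+n; *-suc)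
open import Data.Fin using (Fin; zero; suc)
open import Data.Fin.Properties using (_≟_; suc-injective)
open import Data.Bool using (true; false)
open import Data.Product using (∃-syntax; _,_; proj₁; proj₂)
open import Data.Sum using (_⊎_; inj₁; inj₂)
open import Data.Empty using (⊥-elim)
open import Data.List using (List; []; _∷_; map; _++_)
open import Data.List.Properties using (map-id; map-∘)
open import Data.List.Relation.Unary.Any using (here; there)
open import Data.List.Relation.Unary.All using (All; []; _∷_)
  renaming (head to All-head; tail to All-tail; lookup to All-lookup)
open import Data.List.Membership.Propositional using (_∈_)
open import Data.List.Membership.Propositional.Properties using (∈-map⁻; ∈-map⁺; ∈-∃++)
open import Data.List.Relation.Binary.Permutation.Propositional
  using (_↭_; prep; swap; ↭-refl; ↭-sym; ↭-trans; ↭-reflexive)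
open import Data.List.Relation.Binary.Permutation.Propositional.Properties
  using (∈-resp-↭; map⁺; ↭-map-inv; filter-↭; ↭-length; All-resp-↭; drop-∷; shift; shifts)
open import Relation.Binary.PropositionalEquality using (_≡_; _≢_; refl; sym; trans; cong; subst; subst₂)
open import Relation.Nullary using (¬_; does; yes; no)
open import Function using (id; _∘_)

Reach-trans : ∀ {m} {E : List (Edge m)} {a b c} → Reach E a b → Reach E b c → Reach E a c
Reach-trans here q = q
Reach-trans (step e p) q = step e (Reach-trans p q)

Reach-map : ∀ {m k} {A : List (Edge m)} {B : List (Edge k)} (f : Fin m → Fin k)
  → (∀ {c d} → (c , d) ∈ A → Reach B (f c) (f d)) → ∀ {a b} → Reach A a b → Reach B (f a) (f b)
Reach-map f h here = here
Reach-map f h (step e p) = Reach-trans (h e) (Reach-map f h p)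

Reach-resp-↭ : ∀ {m} {E E' : List (Edge m)} → E ↭ E' → ∀ {a b} → Reach E a b → Reach E' a b
Reach-resp-↭ p = Reach-map id (λ e → step (∈-resp-↭ p e) here)

Reach-closed : ∀ {m} {E : List (Edge m)} (P : Fin m → Set)
  → (∀ {c d} → (c , d) ∈ E → P c → P d) → ∀ {a b} → Reach E a b → P a → P b
Reach-closed P h here pa = pa
Reach-closed P h (step e r) pa = Reach-closed P h r (h e pa)

indeg-resp-↭ : ∀ {m} {E E' : List (Edge m)} → E ↭ E' → ∀ w → indeg E w ≡ indeg E' w
indeg-resp-↭ p w = ↭-length (filter-↭ (λ e → proj₂ e ≟ w) p)

outdeg-resp-↭ : ∀ {m} {E E' : List (Edge m)} → E ↭ E' → ∀ w → outdeg E w ≡ outdeg E' w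
outdeg-resp-↭ p w = ↭-length (filter-↭ (λ e → proj₁ e ≟ w) p)

indeg-liftE-old : ∀ {m} (E : List (Edge m)) w → indeg (liftE E) (old w) ≡ indeg E w
indeg-liftE-old [] w = refl
indeg-liftE-old (e ∷ E) w with does (proj₂ e ≟ w)
... | true = cong suc (indeg-liftE-old E w)
... | false = indeg-liftE-old E w

outdeg-liftE-old : ∀ {m} (E : List (Edge m)) w → outdeg (liftE E) (old w) ≡ outdeg E w
outdeg-liftE-old [] w = refl
outdeg-liftE-old (e ∷ E) w with does (proj₁ e ≟ w)
... | true = cong suc (outdeg-liftE-old E w)
... | false = outdeg-liftE-old E w

indeg-liftE-new₀ : ∀ {m} (E : List (Edge m)) → indeg (liftE E) new₀ ≡ 0
indeg-liftE-new₀ [] = refl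
indeg-liftE-new₀ (e ∷ E) = indeg-liftE-new₀ E

outdeg-liftE-new₀ : ∀ {m} (E : List (Edge m)) → outdeg (liftE E) new₀ ≡ 0
outdeg-liftE-new₀ [] = refl
outdeg-liftE-new₀ (e ∷ E) = outdeg-liftE-new₀ E

indeg-liftE-new₁ : ∀ {m} (E : List (Edge m)) → indeg (liftE E) new₁ ≡ 0
indeg-liftE-new₁ [] = refl
indeg-liftE-new₁ (e ∷ E) = indeg-liftE-new₁ E

outdeg-liftE-new₁ : ∀ {m} (E : List (Edge m)) → outdeg (liftE E) new₁ ≡ 0
outdeg-liftE-new₁ [] = refl
outdeg-liftE-new₁ (e ∷ E) = outdeg-liftE-new₁ E

old-injective : ∀ {m} {x y : Fin m} → old x ≡ old y → x ≡ y
old-injective = suc-injective ∘ suc-injective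

old-≢ : ∀ {m} {x y : Fin m} → x ≢ y → old x ≢ old y
old-≢ x≢y = x≢y ∘ old-injective

liftEdge : ∀ {m} → Edge m → Edge (2 + m)
liftEdge e = old (proj₁ e) , old (proj₂ e)

Avoids : ∀ {k} → Fin k → Edge k → Set
Avoids x e = proj₁ e ≢ x × proj₂ e ≢ x

liftE-avoids-old : ∀ {m} {x : Fin m} {S : List (Edge m)} → All (Avoids x) S → All (Avoids (old x)) (liftE S)
liftE-avoids-old [] = []
liftE-avoids-old ((h₁ , h₂) ∷ hs) = (old-≢ h₁ , old-≢ h₂) ∷ liftE-avoids-old hs

liftE-avoids-old⁻ : ∀ {m} {x : Fin m} (S : List (Edge m)) → All (Avoids (old x)) (liftE S) → All (Avoids x) S
liftE-avoids-old⁻ [] [] = []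
liftE-avoids-old⁻ (e ∷ S) ((h₁ , h₂) ∷ hs) =
  (h₁ ∘ cong old , h₂ ∘ cong old) ∷ liftE-avoids-old⁻ S hs

liftE-avoids-new₁ : ∀ {m} (S : List (Edge m)) → All (Avoids new₁) (liftE S)
liftE-avoids-new₁ [] = []
liftE-avoids-new₁ (e ∷ S) = ((λ ()) , (λ ())) ∷ liftE-avoids-new₁ S

Embeds-refl : ∀ {n} (G : RawGraph n) → Embeds G G
Embeds-refl G = id , id , ↭-reflexive (map-id (edges G)) , refl , λ _ → refl

Embeds-trans : ∀ {n} {A B C : RawGraph n} → Embeds A B → Embeds B C → Embeds A C
Embeds-trans {A = A} (φ , φ-inj , φ-edges , φ-root , φ-leaf) (ψ , ψ-inj , ψ-edges , ψ-root , ψ-leaf) =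
  ψ ∘ φ , φ-inj ∘ ψ-inj
  , ↭-trans (↭-reflexive (map-∘ (edges A))) (↭-trans (map⁺ _ φ-edges) ψ-edges)
  , trans (cong ψ φ-root) ψ-root , λ i → trans (cong ψ (φ-leaf i)) (ψ-leaf i)

Steps-map : ∀ {n} {R R' : Network n → Network n → Set} → (∀ A B → R A B → R' A B)
  → ∀ {k N N'} → Steps R k N N' → Steps R' k N N'
Steps-map f (done e) = done e
Steps-map f (more r s) = more (f _ _ r) (Steps-map f s)

2+-mono-2* : ∀ {j k} → j ≤ 2 * k → 2 + j ≤ 2 * suc k
2+-mono-2* {k = k} j≤2k = ≤-trans (s≤s (s≤s j≤2k)) (≤-reflexive (sym (*-suc 2 k)))

Steps-subdivide : ∀ {n} {R R' : Network n → Network n → Set}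
  → (∀ A B → R A B → R' A B ⊎ ∃[ X ] (R' A X × R' X B))
  → ∀ {k N N'} → Steps R k N N' → ∃[ j ] (j ≤ 2 * k × Steps R' j N N')
Steps-subdivide f (done e) = 0 , z≤n , done e
Steps-subdivide f (more r s) with Steps-subdivide f s | f _ _ r
... | j , j≤2k , s' | inj₁ r' = suc j , ≤-trans (n≤1+n _) (2+-mono-2* j≤2k) , more r' s'
... | j , j≤2k , s' | inj₂ (X , r₁ , r₂) = 2 + j , 2+-mono-2* j≤2k , more r₁ (more r₂ s')

module HeadMove {n : ℕ} (N : Network n) where
  private
    G : RawGraph n
    G = graph N
    m : ℕ
    m = size G
    E : List (Edge m)
    E = edges G
  open IsNetwork (isNetwork N)

  -- u' = new₁ subdivides (u,v) and v' = new₀ subdivides (a,b).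
  module PlusMinus (u v a b : Fin m) (T : List (Edge m))
                   (E-split : E ↭ (u , v) ∷ (a , b) ∷ T)
                   (b↛u : ¬ Reach ((a , b) ∷ T) b u)
                   (v-ret : IsReticulation G v) where

    plusEdges : List (Edge (2 + m))
    plusEdges = (old u , new₁) ∷ (new₁ , old v) ∷ (new₁ , new₀)
              ∷ (old a , new₀) ∷ (new₀ , old b) ∷ liftE T

    subdividedEdges : List (Edge (2 + m))
    subdividedEdges = (old a , new₀) ∷ (new₀ , old b) ∷ (old u , old v) ∷ liftE T

    indeg-old : ∀ w → indeg plusEdges (old w) ≡ indeg E w
    indeg-old w = trans count (sym (indeg-resp-↭ E-split w))
      where
      count : indeg plusEdges (old w) ≡ indeg ((u , v) ∷ (a , b) ∷ T) w
      count with does (v ≟ w)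
      ... | true with does (b ≟ w)
      ...   | true  = cong (2 +_) (indeg-liftE-old T w)
      ...   | false = cong suc (indeg-liftE-old T w)
      count | false with does (b ≟ w)
      ...   | true  = cong suc (indeg-liftE-old T w)
      ...   | false = indeg-liftE-old T w

    outdeg-old : ∀ w → outdeg plusEdges (old w) ≡ outdeg E w
    outdeg-old w = trans count (sym (outdeg-resp-↭ E-split w))
      where
      count : outdeg plusEdges (old w) ≡ outdeg ((u , v) ∷ (a , b) ∷ T) w
      count with does (u ≟ w)
      ... | true with does (a ≟ w)
      ...   | true  = cong (2 +_) (outdeg-liftE-old T w)
      ...   | false = cong suc (outdeg-liftE-old T w)
      count | false with does (a ≟ w)
      ...   | true  = cong suc (outdeg-liftE-old T w)
      ...   | false = outdeg-liftE-old T w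

    degrees-old : ∀ {w i o} → indeg E w ≡ i × outdeg E w ≡ o
                → indeg plusEdges (old w) ≡ i × outdeg plusEdges (old w) ≡ o
    degrees-old (hi , ho) = trans (indeg-old _) hi , trans (outdeg-old _) ho

    -- Contains everything reachable from new₀, but not old u, since b ↛ u.
    FromNew₀ : Fin (2 + m) → Set
    FromNew₀ z = z ≡ new₀ ⊎ ∃[ w ] (z ≡ old w × Reach ((a , b) ∷ T) b w)

    FromNew₀-liftE : ∀ {c d} → (c , d) ∈ liftE T → FromNew₀ c → FromNew₀ d
    FromNew₀-liftE e from-c with ∈-map⁻ liftEdge e | from-c
    ... | (c' , d') , e' , refl | inj₂ (w , refl , r) = inj₂ (d' , refl , Reach-trans r (step (there e') here))

    FromNew₀-plus : ∀ {c d} → (c , d) ∈ plusEdges → FromNew₀ c → FromNew₀ d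
    FromNew₀-plus (here refl) (inj₂ (w , refl , r)) = ⊥-elim (b↛u r)
    FromNew₀-plus (there (here refl)) (inj₂ (w , () , r))
    FromNew₀-plus (there (there (here refl))) (inj₂ (w , () , r))
    FromNew₀-plus (there (there (there (here refl)))) _ = inj₁ refl
    FromNew₀-plus (there (there (there (there (here refl))))) _ = inj₂ (b , refl , here)
    FromNew₀-plus (there (there (there (there (there e))))) from-c = FromNew₀-liftE e from-c

    FromNew₀-subdivided : ∀ {c d} → (c , d) ∈ subdividedEdges → FromNew₀ c → FromNew₀ d
    FromNew₀-subdivided (here refl) _ = inj₁ refl
    FromNew₀-subdivided (there (here refl)) _ = inj₂ (b , refl , here)
    FromNew₀-subdivided (there (there (here refl))) (inj₂ (w , refl , r)) = ⊥-elim (b↛u r)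
    FromNew₀-subdivided (there (there (there e))) from-c = FromNew₀-liftE e from-c

    new₀↛new₁ : ¬ Reach plusEdges new₀ new₁
    new₀↛new₁ r with Reach-closed FromNew₀ FromNew₀-plus r (inj₁ refl)
    ... | inj₂ (_ , () , _)

    new₀↛u : ¬ Reach subdividedEdges new₀ (old u)
    new₀↛u r with Reach-closed FromNew₀ FromNew₀-subdivided r (inj₁ refl)
    ... | inj₂ (_ , refl , b⇝u) = b↛u b⇝u

    collapse : Fin (2 + m) → Fin m
    collapse zero = b
    collapse (suc zero) = v
    collapse (suc (suc w)) = w

    data PlusEdge : Fin (2 + m) → Fin (2 + m) → Set where
      added  : PlusEdge new₁ new₀
      into-v : PlusEdge new₁ (old v)
      into-b : PlusEdge new₀ (old b)
      lifted : ∀ {c d} → (collapse c , collapse d) ∈ E → PlusEdge c d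

    classify : ∀ {c d} → (c , d) ∈ plusEdges → PlusEdge c d
    classify (here refl) = lifted (∈-resp-↭ (↭-sym E-split) (here refl))
    classify (there (here refl)) = into-v
    classify (there (there (here refl))) = added
    classify (there (there (there (here refl)))) = lifted (∈-resp-↭ (↭-sym E-split) (there (here refl)))
    classify (there (there (there (there (here refl))))) = into-b
    classify (there (there (there (there (there e))))) with ∈-map⁻ liftEdge e
    ... | _ , e' , refl = lifted (∈-resp-↭ (↭-sym E-split) (there (there e')))

    project-path : ∀ {s t} → Reach plusEdges s t
                 → Reach E (collapse s) (collapse t) ⊎ (Reach plusEdges new₀ t × Reach plusEdges s new₁)
    project-path here = inj₁ here
    project-path (step e r) with classify e | project-path r
    ... | added     | _              = inj₂ (r , here)
    ... | into-v    | inj₁ r'        = inj₁ r'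
    ... | into-b    | inj₁ r'        = inj₁ r'
    ... | lifted e' | inj₁ r'        = inj₁ (step e' r')
    ... | into-v    | inj₂ (r₁ , r₂) = inj₂ (r₁ , step e r₂)
    ... | into-b    | inj₂ (r₁ , r₂) = inj₂ (r₁ , step e r₂)
    ... | lifted _  | inj₂ (r₁ , r₂) = inj₂ (r₁ , step e r₂)

    no-cycle-lifted : ∀ {c d} → (c , d) ∈ plusEdges → (collapse c , collapse d) ∈ E
                    → ¬ Reach plusEdges d c
    no-cycle-lifted e e' r with project-path r
    ... | inj₁ r' = acyclic e' r'
    ... | inj₂ (r₁ , r₂) = new₀↛new₁ (Reach-trans r₁ (step e r₂))

    -- Every edge out of an old vertex is lifted, so a cycle through old w has a lifted edge.
    no-cycle-into-old : ∀ {c w} → (c , old w) ∈ plusEdges → ¬ Reach plusEdges (old w) c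
    no-cycle-into-old e here with classify e
    ... | lifted e' = acyclic e' here
    no-cycle-into-old e (step e₂ r) with classify e₂
    ... | lifted e₂' = no-cycle-lifted e₂ e₂' (Reach-trans r (step e here))

    plus-acyclic : ∀ {c d} → (c , d) ∈ plusEdges → ¬ Reach plusEdges d c
    plus-acyclic e with classify e
    ... | added = new₀↛new₁
    ... | into-v = no-cycle-into-old e
    ... | into-b = no-cycle-into-old e
    ... | lifted e' = no-cycle-lifted e e'

    plusIsNetwork : IsNetwork (result N plusEdges)
    plusIsNetwork = record
      { root-deg = degrees-old root-deg
      ; leaf-deg = degrees-old ∘ leaf-deg
      ; leaf-inj = leaf-inj ∘ old-injective
      ; kinds    = plus-kinds
      ; acyclic  = plus-acyclic
      }
      where
      plus-kinds : ∀ x → x ≡ old (root G)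
                       ⊎ (∃[ i ] old (leaf G i) ≡ x)
                       ⊎ (indeg plusEdges x ≡ 1 × outdeg plusEdges x ≡ 2)
                       ⊎ (indeg plusEdges x ≡ 2 × outdeg plusEdges x ≡ 1)
      plus-kinds zero =
        inj₂ (inj₂ (inj₂ (cong (2 +_) (indeg-liftE-new₀ T) , cong suc (outdeg-liftE-new₀ T))))
      plus-kinds (suc zero) =
        inj₂ (inj₂ (inj₁ (cong suc (indeg-liftE-new₁ T) , cong (2 +_) (outdeg-liftE-new₁ T))))
      plus-kinds (suc (suc w)) with kinds w
      ... | inj₁ eq = inj₁ (cong old eq)
      ... | inj₂ (inj₁ (i , eq)) = inj₂ (inj₁ (i , cong old eq))
      ... | inj₂ (inj₂ (inj₁ tree)) = inj₂ (inj₂ (inj₁ (degrees-old tree)))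
      ... | inj₂ (inj₂ (inj₂ ret)) = inj₂ (inj₂ (inj₂ (degrees-old ret)))

    plusNetwork : Network n
    plusNetwork = record { graph = result N plusEdges ; isNetwork = plusIsNetwork }

    plus-step : SNPR N plusNetwork
    plus-step = plusEdges , inj₂ (inj₁ plus) , Embeds-refl (result N plusEdges)
      where
      plus : PRplus N plusEdges
      plus = a , b , liftE ((u , v) ∷ T) , old u , old v , (old a , new₀) ∷ (new₀ , old b) ∷ liftE T
           , ↭-trans (map⁺ liftEdge E-split) (swap _ _ ↭-refl)
           , ↭-trans (prep _ (swap _ _ ↭-refl)) (swap _ _ ↭-refl)
           , new₀↛u , refl

    suppressedNew₁ : List (Edge (2 + (2 + m)))
    suppressedNew₁ = (old (old u) , old new₀) ∷ (old (old a) , old new₀) ∷ (old new₀ , old (old b))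
                   ∷ liftE (liftE T)

    minus-step : ∀ {N' : Network n} {F F'} → Embeds (graph N') (result N F)
               → Suppress (old (old v)) suppressedNew₁ F' → map liftEdge F ↭ F'
               → SNPR plusNetwork N'
    minus-step {F = F} {F'} N'↪F supp-v F-F' = F' , inj₂ (inj₂ minus) , Embeds-trans N'↪F F↪F'
      where
      supp-new₁ : Suppress (old new₁) _ suppressedNew₁
      supp-new₁ = old (old u) , old new₀ , _ , ↭-refl
                , ((λ ()) , (λ ())) ∷ ((λ ()) , (λ ())) ∷ liftE-avoids-old (liftE-avoids-new₁ T) , refl
      minus : PRminus plusNetwork F'
      minus = new₁ , old v , _ , suppressedNew₁ , swap _ _ ↭-refl
            , inj₁ (cong suc (indeg-liftE-new₁ T) , cong (2 +_) (outdeg-liftE-new₁ T))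
            , degrees-old v-ret , supp-new₁ , supp-v
      F↪F' : Embeds (result N F) (result plusNetwork F')
      F↪F' = old , old-injective , F-F' , refl , λ _ → refl

  -- A head PR0 on (u,v), where (p,v) and (v,q) are the other edges at v.
  module HeadData (u v p q : Fin m) (S : List (Edge m))
                  (E-split : E ↭ (u , v) ∷ (p , v) ∷ (v , q) ∷ S)
                  (S-avoids-v : All (Avoids v) S)
                  (v-ret : IsReticulation G v) where

    private
      in-E : ∀ {e} → e ∈ (u , v) ∷ (p , v) ∷ (v , q) ∷ S → e ∈ E
      in-E = ∈-resp-↭ (↭-sym E-split)

    u≢v : u ≢ v
    u≢v refl = acyclic (in-E (here refl)) here

    p≢v : p ≢ v
    p≢v refl = acyclic (in-E (there (here refl))) here

    q≢v : q ≢ v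
    q≢v refl = acyclic (in-E (there (there (here refl)))) here

    mergedEdges : List (Edge (2 + m))
    mergedEdges = (old p , old q) ∷ liftE S

    merge : Fin m → Fin (2 + m)
    merge w with w ≟ v
    ... | yes _ = old q
    ... | no _ = old w

    merge-v : merge v ≡ old q
    merge-v with v ≟ v
    ... | yes _ = refl
    ... | no v≢v = ⊥-elim (v≢v refl)

    merge-≢v : ∀ {w} → w ≢ v → merge w ≡ old w
    merge-≢v {w} w≢v with w ≟ v
    ... | yes w≡v = ⊥-elim (w≢v w≡v)
    ... | no _ = refl

    merge-path : ∀ {c d} → (c , d) ∈ (p , v) ∷ (v , q) ∷ S → Reach mergedEdges (merge c) (merge d)
    merge-path (here refl) =
      subst₂ (Reach mergedEdges) (sym (merge-≢v p≢v)) (sym merge-v) (step (here refl) here)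
    merge-path (there (here refl)) = subst₂ (Reach mergedEdges) (sym merge-v) (sym (merge-≢v q≢v)) here
    merge-path (there (there e)) with All-lookup S-avoids-v e
    ... | c≢v , d≢v = subst₂ (Reach mergedEdges) (sym (merge-≢v c≢v)) (sym (merge-≢v d≢v))
                        (step (there (∈-map⁺ liftEdge e)) here)

    unmerged-↛u : ∀ {E'} → E' ↭ (p , v) ∷ (v , q) ∷ S → ∀ {s} → s ≢ v
                → ¬ Reach mergedEdges (old s) (old u) → ¬ Reach E' s u
    unmerged-↛u E'-split s≢v s↛u r =
      s↛u (subst₂ (Reach mergedEdges) (merge-≢v s≢v) (merge-≢v u≢v)
                  (Reach-map merge merge-path (Reach-resp-↭ E'-split r)))

    onto-merged : ∀ {N' : Network n} (R : List (Edge (2 + m)))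
                → liftE S ↭ R → ¬ Reach mergedEdges (old q) (old u)
                → Embeds (graph N') (result N ((old p , new₀) ∷ (new₀ , old q) ∷ (old u , new₀) ∷ R))
                → ∃[ X ] (SNPR N X × SNPR X N')
    onto-merged {N'} R S-R q↛u N'↪F = plusNetwork , plus-step , minus-step {N'} N'↪F supp-v F-F'
      where
      -- (p,q) is not an edge of N; the PR+ subdivides (v,q) instead.
      open PlusMinus u v v q ((p , v) ∷ S) (↭-trans E-split (prep _ (swap _ _ ↭-refl)))
                     (unmerged-↛u (swap _ _ ↭-refl) q≢v q↛u) v-ret
      F' : List (Edge (2 + (2 + m)))
      F' = (old (old p) , old new₀) ∷ (old (old u) , old new₀) ∷ (old new₀ , old (old q)) ∷ liftE (liftE S)
      supp-v : Suppress (old (old v)) suppressedNew₁ F'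
      supp-v = old (old p) , old new₀ , _
             , ↭-trans (shifts (_ ∷ _ ∷ _ ∷ []) (_ ∷ [])) (prep _ (swap _ _ ↭-refl))
             , (old-≢ (old-≢ u≢v) , λ ()) ∷ ((λ ()) , old-≢ (old-≢ q≢v))
               ∷ liftE-avoids-old (liftE-avoids-old S-avoids-v)
             , refl
      F-F' : map liftEdge ((old p , new₀) ∷ (new₀ , old q) ∷ (old u , new₀) ∷ R) ↭ F'
      F-F' = prep _ (swap _ _ (map⁺ liftEdge (↭-sym S-R)))

    onto-other : ∀ {N' : Network n} (x y : Fin m) (S' : List (Edge m)) (R : List (Edge (2 + m)))
               → S ↭ (x , y) ∷ S' → R ↭ (old p , old q) ∷ liftE S'
               → ¬ Reach mergedEdges (old y) (old u)
               → Embeds (graph N') (result N ((old x , new₀) ∷ (new₀ , old y) ∷ (old u , new₀) ∷ R))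
               → ∃[ X ] (SNPR N X × SNPR X N')
    onto-other {N'} x y S' R S-split R-split y↛u N'↪F =
      plusNetwork , plus-step , minus-step {N'} N'↪F supp-v F-F'
      where
      xy-S'-avoid : All (Avoids v) ((x , y) ∷ S')
      xy-S'-avoid = All-resp-↭ S-split S-avoids-v
      x≢v : x ≢ v
      x≢v = proj₁ (All-head xy-S'-avoid)
      y≢v : y ≢ v
      y≢v = proj₂ (All-head xy-S'-avoid)
      rest : (p , v) ∷ (v , q) ∷ S ↭ (x , y) ∷ (p , v) ∷ (v , q) ∷ S'
      rest = ↭-trans (prep _ (prep _ S-split)) (↭-trans (prep _ (swap _ _ ↭-refl)) (swap _ _ ↭-refl))
      open PlusMinus u v x y ((p , v) ∷ (v , q) ∷ S') (↭-trans E-split (prep _ rest))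
                     (unmerged-↛u (↭-sym rest) y≢v y↛u) v-ret
      F' : List (Edge (2 + (2 + m)))
      F' = (old (old p) , old (old q)) ∷ (old (old u) , old new₀) ∷ (old (old x) , old new₀)
         ∷ (old new₀ , old (old y)) ∷ liftE (liftE S')
      supp-v : Suppress (old (old v)) suppressedNew₁ F'
      supp-v = old (old p) , old (old q) , _
             , shifts (_ ∷ _ ∷ _ ∷ []) (_ ∷ _ ∷ [])
             , (old-≢ (old-≢ u≢v) , λ ()) ∷ (old-≢ (old-≢ x≢v) , λ ())
               ∷ ((λ ()) , old-≢ (old-≢ y≢v))
               ∷ liftE-avoids-old (liftE-avoids-old (All-tail xy-S'-avoid))
             , refl
      F-F' : map liftEdge ((old x , new₀) ∷ (new₀ , old y) ∷ (old u , new₀) ∷ R) ↭ F'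
      F-F' = ↭-trans (prep _ (prep _ (prep _ (map⁺ liftEdge R-split))))
               (↭-trans (shifts (_ ∷ _ ∷ _ ∷ []) (_ ∷ [])) (prep _ (shifts (_ ∷ _ ∷ []) (_ ∷ []))))

  head-as-plus-minus : ∀ {N' : Network n} F → HeadPR0 N F → Embeds (graph N') (result N F)
                     → ∃[ X ] (SNPR N X × SNPR X N')
  head-as-plus-minus {N'} F
    (u , v , R₀ , R₁ , x , y , R₂ , E-split , v-ret
    , (p , q , R , R₀-split , R-avoids , refl) , R₁-split , y↛u , refl) N'↪F
    with ↭-map-inv liftEdge E-split
  ... | (_ ∷ E₀ , refl , E-split') with ↭-map-inv liftEdge R₀-split
  ...   | ((p₀ , _) ∷ (_ , q₀) ∷ S , refl , E₀-split) = onto (∈-resp-↭ (↭-sym R₁-split) (here refl))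
    where
    open HeadData u v p₀ q₀ S (↭-trans E-split' (prep _ E₀-split)) (liftE-avoids-old⁻ S R-avoids) v-ret
    onto : (x , y) ∈ mergedEdges → ∃[ X ] (SNPR N X × SNPR X N')
    onto (here refl) = onto-merged {N'} R₂ (drop-∷ R₁-split) y↛u N'↪F
    onto (there e) with ∈-map⁻ liftEdge e
    ... | (x₀ , y₀) , e' , refl with ∈-∃++ e'
    ...   | S₁ , S₂ , S≡ =
      onto-other {N'} x₀ y₀ (S₁ ++ S₂) R₂ S-split (drop-∷ R₂-split) y↛u N'↪F
      where
      S-split : S ↭ (x₀ , y₀) ∷ S₁ ++ S₂
      S-split = subst (_↭ (x₀ , y₀) ∷ S₁ ++ S₂) (sym S≡) (shift _ S₁ S₂)
      R₂-split : (old x₀ , old y₀) ∷ R₂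
               ↭ (old x₀ , old y₀) ∷ (old p₀ , old q₀) ∷ liftE (S₁ ++ S₂)
      R₂-split = ↭-trans (↭-sym R₁-split) (↭-trans (prep _ (map⁺ liftEdge S-split)) (swap _ _ ↭-refl))

SNPR⇒PR : ∀ {n} (N N' : Network n) → SNPR N N' → PR N N'
SNPR⇒PR _ _ (F , inj₁ tail , e) = F , inj₁ tail , e
SNPR⇒PR _ _ (F , inj₂ (inj₁ plus) , e) = F , inj₂ (inj₂ (inj₁ plus)) , e
SNPR⇒PR _ _ (F , inj₂ (inj₂ minus) , e) = F , inj₂ (inj₂ (inj₂ minus)) , e

PR⇒SNPR-or-SNPR² : ∀ {n} (N N' : Network n) → PR N N' → SNPR N N' ⊎ ∃[ X ] (SNPR N X × SNPR X N')
PR⇒SNPR-or-SNPR² _ _ (F , inj₁ tail , e) = inj₁ (F , inj₁ tail , e)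
PR⇒SNPR-or-SNPR² N N' (F , inj₂ (inj₁ head) , e) = inj₂ (HeadMove.head-as-plus-minus N {N'} F head e)
PR⇒SNPR-or-SNPR² _ _ (F , inj₂ (inj₂ (inj₁ plus)) , e) = inj₁ (F , inj₂ (inj₁ plus) , e)
PR⇒SNPR-or-SNPR² _ _ (F , inj₂ (inj₂ (inj₂ minus)) , e) = inj₁ (F , inj₂ (inj₂ minus) , e)

lemma5p4 : ∀ {n} (N N' : Network n) (dPR dSNPR : ℕ)
           → IsDist PR N N' dPR → IsDist SNPR N N' dSNPR
           → dPR ≤ dSNPR × dSNPR ≤ 2 * dPR
lemma5p4 N N' dPR dSNPR (pr , pr-minimal) (snpr , snpr-minimal)
  with Steps-subdivide PR⇒SNPR-or-SNPR² pr
... | j , j≤2dPR , snpr' =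
  pr-minimal dSNPR (Steps-map SNPR⇒PR snpr) , ≤-trans (snpr-minimal j snpr') j≤2dPR
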